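{- Let $t,k$ be integers with $t\ge 3$ and $k\ge 3$, let $G$ be a $(K_t,\mathcal{T}_k)$-co-critical graph on $n$ vertices, and let $\tau:E(G)\to\{\text{red},\text{blue}\}$ be a critical-coloring of $G$. Then: (a) for every component $D$ of $G_b$, $|D|\le k-1$ and $G[V(D)]$ is the complete graph $K_{|D|}$; (b) if $D_1,\ldots,D_q$ are the components of $G_b$ with $|D_i|<k/2$ for all $i\in[q]$, then for all distinct $i,j\in[q]$ the set $V(D_i)$ is complete to $V(D_j)$ in $G_r$ (every vertex of $V(D_i)$ is joined by a red edge to every vertex of $V(D_j)$), and consequently $q\le t-1$.
   Context: All graphs are finite and simple. $\mathcal{T}_k$ denotes the family of all trees on $k$ vertices. For a graph $G$ we write $G\to(K_t,\mathcal{T}_k)$ if every 2-coloring of $E(G)$ with colors red and blue contains a red $K_t$ or a blue copy of some tree in $\mathcal{T}_k$. A non-complete graph $G$ is $(K_t,\mathcal{T}_k)$-co-critical if $G\not\to(K_t,\mathcal{T}_k)$ but $G+e\to(K_t,\mathcal{T}_k)$ for every edge $e$ of the complement $\overline{G}$. For a coloring $\tau:E(G)\to\{\text{red},\text{blue}\}$ with color classes $E_r,E_b$, $G_r$ and $G_b$ denote the spanning subgraphs of $G$ with edge sets $E_r$ and $E_b$; $\tau$ is a critical-coloring if $G_r$ is $K_t$-free and $G_b$ contains no tree on $k$ vertices. $|D|$ is the number of vertices of $D$ and $[q]=\{1,\ldots,q\}$. -}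

module Defs where

open import Data.Nat using (ℕ; zero; suc; _+_; _*_; _∸_; _≤_; _<_)
open import Data.Fin using (Fin; zero; suc; inject₁; fromℕ; _≟_)
open import Data.Bool using (Bool; true; false; _∧_; _∨_; not)
open import Data.Product using (Σ; ∃; _×_; _,_)
open import Data.Sum using (_⊎_)
open import Relation.Nullary using (¬_)
open import Relation.Nullary.Decidable using (⌊_⌋)
open import Relation.Binary.PropositionalEquality using (_≡_; _≢_)
open import Relation.Binary.Construct.Closure.ReflexiveTransitive using (Star)
open import Function.Definitions using (Injective)

Adj : ℕ → Set
Adj n = Fin n → Fin n → Bool

IsSimple : ∀ {n} → Adj n → Set
IsSimple {n} A = (∀ (x y : Fin n) → A x y ≡ A y x) × (∀ (x : Fin n) → A x x ≡ false)

addEdge : ∀ {n} → Adj n → Fin n → Fin n → Adj n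
addEdge A u v x y =
  A x y ∨ ((⌊ x ≟ u ⌋ ∧ ⌊ y ≟ v ⌋) ∨ (⌊ x ≟ v ⌋ ∧ ⌊ y ≟ u ⌋))

data Colour : Set where
  red blue : Colour

isRed : Colour → Bool
isRed red = true
isRed blue = false

-- a 2-colouring of the edges (a symmetric colouring of all pairs; only
-- its values on edges matter)
record Colouring (n : ℕ) : Set where
  field
    col : Fin n → Fin n → Colour
    col-sym : ∀ x y → col x y ≡ col y x
open Colouring public

redAdj : ∀ {n} → Adj n → Colouring n → Adj n
redAdj A c x y = A x y ∧ isRed (col c x y)

blueAdj : ∀ {n} → Adj n → Colouring n → Adj n
blueAdj A c x y = A x y ∧ not (isRed (col c x y))

HasClique : ∀ {n} → Adj n → ℕ → Set
HasClique {n} A t =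
  Σ (Fin t → Fin n) λ f → Injective _≡_ _≡_ f ×
    (∀ i j → i ≢ j → A (f i) (f j) ≡ true)

Reach : ∀ {n} → Adj n → Fin n → Fin n → Set
Reach A = Star (λ x y → A x y ≡ true)

Connected : ∀ {k} → Adj k → Set
Connected {k} A = ∀ (x y : Fin k) → Reach A x y

HasCycle : ∀ {k} → Adj k → Set
HasCycle {k} A = Σ ℕ λ m → Σ (Fin (suc (suc (suc m))) → Fin k) λ c →
  Injective _≡_ _≡_ c ×
  (∀ (i : Fin (suc (suc m))) → A (c (inject₁ i)) (c (suc i)) ≡ true) ×
  (A (c (fromℕ (suc (suc m)))) (c zero) ≡ true)

IsTree : ∀ {k} → Adj k → Set
IsTree T = IsSimple T × Connected T × ¬ HasCycle T

HasTree : ∀ {n} → Adj n → ℕ → Set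
HasTree {n} A k = Σ (Adj k) λ T → IsTree T ×
  Σ (Fin k → Fin n) λ f → Injective _≡_ _≡_ f ×
    (∀ x y → T x y ≡ true → A (f x) (f y) ≡ true)

Arrows : ∀ {n} → Adj n → ℕ → ℕ → Set
Arrows {n} A t k = ∀ (c : Colouring n) →
  HasClique (redAdj A c) t ⊎ HasTree (blueAdj A c) k

-- (K_t, T_k)-co-critical (G assumed simple)
CoCritical : ∀ {n} → Adj n → ℕ → ℕ → Set
CoCritical {n} A t k =
  (Σ (Fin n) λ u → Σ (Fin n) λ v → u ≢ v × A u v ≡ false) ×
  ¬ Arrows A t k ×
  (∀ (u v : Fin n) → u ≢ v → A u v ≡ false → Arrows (addEdge A u v) t k)

CriticalColouring : ∀ {n} → Adj n → ℕ → ℕ → Colouring n → Set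
CriticalColouring A t k c =
  ¬ HasClique (redAdj A c) t × ¬ HasTree (blueAdj A c) k

HasSize : ∀ {n} → (Fin n → Set) → ℕ → Set
HasSize {n} P m = Σ (Fin m → Fin n) λ f → Injective _≡_ _≡_ f ×
  (∀ i → P (f i)) × (∀ u → P u → Σ (Fin m) λ i → f i ≡ u)

Comp : ∀ {n} → Adj n → Fin n → Fin n → Set
Comp A v u = Reach A v u

SmallComp : ∀ {n} → Adj n → ℕ → Fin n → Set
SmallComp A k v = Σ ℕ λ m → HasSize (Comp A v) m × 2 * m < k

module Submission where

-- Two facts drive everything.
--  * Tree growth: a connected vertex set of size at least k in a graph
--    contains a tree on k vertices.  We grow a rooted tree inside the blue
--    component one leaf at a time (every walk leaving the current tree has
--    an edge leaving it), recording trees by a parent function that points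
--    to earlier vertices; such parent graphs are trees.
--  * Adding an edge: if uv is a non-edge of G, colour uv blue and keep c
--    elsewhere.  G + uv arrows, there is no new red edge, and c is critical,
--    so a blue tree on k vertices appears and must use uv; hence its k
--    vertices lie in the blue components of u and v.
-- Part (a): a blue component of size at least k would contain a blue tree,
-- and a non-edge inside one component would put k vertices into it.
-- Part (b): a non-edge between two components with fewer than k/2 vertices
-- would put k vertices into their union; any other edge between them is
-- red.  So representatives of q such components span a red K_q, and q < t.

open import Defs
open import Data.Nat using (ℕ; zero; suc; _+_; _*_; _∸_; _≤_; _<_; z≤n; s≤s; _≤?_)
import Data.Nat.Properties as ℕ
open import Data.Nat.Solver using (module +-*-Solver)
open import Data.Fin using (Fin; zero; suc; toℕ; inject₁; fromℕ; join; splitAt; inject≤; _≟_)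
open import Data.Fin.Properties
  using ( suc-injective; toℕ-inject₁; toℕ-fromℕ; toℕ≤pred[n]; splitAt-join
        ; inject≤-injective; injective⇒≤; all?; any?; ¬∀⟶∃¬ )
open import Data.Fin.Relation.Unary.Top using (view; ‵fromℕ; ‵inject₁)
open import Data.Fin.Induction using (<-wellFounded)
open import Induction.WellFounded using (Acc; acc)
open import Data.List using (allFin)
import Data.List.Relation.Unary.All as All
open import Data.List.Membership.Propositional.Properties using (∈-allFin)
open import Data.List.Extrema.Nat using (argmax; f[xs]≤f[argmax])
open import Data.Bool using (Bool; true; false; _∧_; _∨_; not; if_then_else_)
import Data.Bool.Properties as Bool
open import Data.Product using (Σ; _×_; _,_; proj₁; proj₂)
open import Data.Sum as Sum using (_⊎_; inj₁; inj₂)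
open import Data.Sum.Properties using (inj₁-injective; inj₂-injective)
open import Data.Empty using (⊥; ⊥-elim)
open import Function using (_∘_)
open import Function.Definitions using (Injective)
open import Relation.Nullary using (¬_; Dec; yes; no)
open import Relation.Nullary.Decidable using (⌊_⌋; _→-dec_)
open import Relation.Binary.PropositionalEquality
  using (_≡_; _≢_; refl; sym; trans; cong; cong₂; subst; subst₂; module ≡-Reasoning)
open import Relation.Binary.Construct.Closure.ReflexiveTransitive
  using (Star; ε; _◅_; _◅◅_; gmap; reverse)

Symmetric : ∀ {n} → Adj n → Set
Symmetric {n} A = ∀ (x y : Fin n) → A x y ≡ A y x

reverseWalk : ∀ {n} {A : Adj n} → Symmetric A → ∀ {x y} → Reach A x y → Reach A y x
reverseWalk symA = reverse (λ {x} {y} e → trans (symA y x) e)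

exitEdge : ∀ {I : Set} {R : I → I → Set} (S : I → Set) → (∀ x → Dec (S x)) →
  ∀ {a b} → Star R a b → S a → ¬ S b → Σ I λ x → Σ I λ y → S x × ¬ S y × R x y
exitEdge S S? ε Sa ¬Sb = ⊥-elim (¬Sb Sa)
exitEdge S S? (_◅_ {j = c} e walk) Sa ¬Sb with S? c
... | yes Sc = exitEdge S S? walk Sc ¬Sb
... | no ¬Sc = _ , c , Sa , ¬Sc , e

-- Counting: bounds on the size of vertex sets.

AtMost : ∀ {n} → (Fin n → Set) → ℕ → Set
AtMost {n} P s = Σ (∀ x → P x → Fin s) λ index →
  ∀ x y (px : P x) (py : P y) → index x px ≡ index y py → x ≡ y

sized⇒atMost : ∀ {n} {P : Fin n → Set} {s} → HasSize P s → AtMost P s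
sized⇒atMost (g , _ , _ , onto) =
  (λ x px → proj₁ (onto x px)) ,
  λ x y px py same → trans (sym (proj₂ (onto x px))) (trans (cong g same) (proj₂ (onto y py)))

atMost-⊆ : ∀ {n} {P Q : Fin n → Set} {s} → (∀ x → P x → Q x) → AtMost Q s → AtMost P s
atMost-⊆ P⊆Q (index , index-inj) =
  (λ x px → index x (P⊆Q x px)) , λ x y px py → index-inj x y (P⊆Q x px) (P⊆Q y py)

atMost-∪ : ∀ {n} {P Q : Fin n → Set} {a b} → AtMost P a → AtMost Q b →
  AtMost (λ x → P x ⊎ Q x) (a + b)
atMost-∪ {P = P} {Q} {a} {b} (indexP , injP) (indexQ , injQ) =
  (λ x pq → join a b (tag x pq)) ,
  λ x y pq pq′ same → tag-injective x y pq pq′ (begin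
    tag x pq                         ≡⟨ splitAt-join a b (tag x pq) ⟨
    splitAt a (join a b (tag x pq))  ≡⟨ cong (splitAt a) same ⟩
    splitAt a (join a b (tag y pq′)) ≡⟨ splitAt-join a b (tag y pq′) ⟩
    tag y pq′                        ∎)
  where
  open ≡-Reasoning
  tag : ∀ x → P x ⊎ Q x → Fin a ⊎ Fin b
  tag x = Sum.map (indexP x) (indexQ x)
  tag-injective : ∀ x y pq pq′ → tag x pq ≡ tag y pq′ → x ≡ y
  tag-injective x y (inj₁ p) (inj₁ p′) same = injP x y p p′ (inj₁-injective same)
  tag-injective x y (inj₂ q) (inj₂ q′) same = injQ x y q q′ (inj₂-injective same)
  tag-injective x y (inj₁ _) (inj₂ _) ()
  tag-injective x y (inj₂ _) (inj₁ _) ()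

atMost-injection : ∀ {n} {P : Fin n → Set} {s k} → AtMost P s →
  (f : Fin k → Fin n) → Injective _≡_ _≡_ f → (∀ j → P (f j)) → k ≤ s
atMost-injection (index , index-inj) f f-inj inP =
  injective⇒≤ {f = λ j → index (f j) (inP j)}
    (λ {i} {j} same → f-inj (index-inj _ _ (inP i) (inP j) same))

InImage : ∀ {n j} → (Fin j → Fin n) → Fin n → Set
InImage {j = j} f x = Σ (Fin j) λ a → f a ≡ x

inImage? : ∀ {n j} (f : Fin j → Fin n) x → Dec (InImage f x)
inImage? f x = any? (λ a → f a ≟ x)

outsideImage : ∀ {n} {P : Fin n → Set} {m j} → HasSize P m → (f : Fin j → Fin n) → j < m →
  Σ (Fin n) λ x → P x × ¬ InImage f x
outsideImage (g , g-inj , inP , _) f j<m with all? (λ l → inImage? f (g l))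
... | no notAll =
  let (l , outside) = ¬∀⟶∃¬ _ _ (λ l → inImage? f (g l)) notAll in g l , inP l , outside
... | yes covered =
  ⊥-elim (ℕ.<⇒≱ j<m (injective⇒≤ {f = λ l → proj₁ (covered l)} preimage-injective))
  where
  preimage-injective : Injective _≡_ _≡_ (λ l → proj₁ (covered l))
  preimage-injective {l} {l′} same =
    g-inj (trans (sym (proj₂ (covered l))) (trans (cong f same) (proj₂ (covered l′))))

-- Trees given by parent functions.

maxPosition : ∀ {L} (h : Fin (suc L) → ℕ) → Σ (Fin (suc L)) λ ℓ → ∀ i → h i ≤ h ℓ
maxPosition h =
  argmax h zero (allFin _) ,
  λ i → All.lookup (f[xs]≤f[argmax] {f = h} zero (allFin _)) (∈-allFin i)

noShortcut : ∀ {m} (i : Fin m) → inject₁ (inject₁ i) ≢ suc (suc i)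
noShortcut zero ()
noShortcut (suc i) e = noShortcut i (suc-injective e)

cycleNeighbours : ∀ {k} (A : Adj k) → Symmetric A →
  ∀ {m} (c : Fin (suc (suc (suc m))) → Fin k) →
  (∀ (i : Fin (suc (suc m))) → A (c (inject₁ i)) (c (suc i)) ≡ true) →
  A (c (fromℕ (suc (suc m)))) (c zero) ≡ true →
  ∀ p → Σ (Fin (suc (suc (suc m)))) λ p₁ → Σ (Fin (suc (suc (suc m)))) λ p₂ →
    p₁ ≢ p₂ × A (c p) (c p₁) ≡ true × A (c p) (c p₂) ≡ true
cycleNeighbours A symA c path close zero =
  suc zero , fromℕ _ , (λ ()) , path zero , trans (symA _ _) close
cycleNeighbours A symA c path close (suc j) with view j
... | ‵fromℕ = inject₁ (fromℕ _) , zero , (λ ()) , trans (symA _ _) (path (fromℕ _)) , close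
... | ‵inject₁ i =
  inject₁ (inject₁ i) , suc (suc i) , noShortcut i ,
  trans (symA _ _) (path (inject₁ i)) , path (suc i)

module ParentGraph {k : ℕ} (par : Fin k → Fin (suc k)) where

  parentOf : Fin (suc k) → Fin (suc k)
  parentOf zero = zero
  parentOf (suc a) = par a

  isChildOf : Fin (suc k) → Fin (suc k) → Bool
  isChildOf zero _ = false
  isChildOf (suc a) y = ⌊ par a ≟ y ⌋

  parentGraph : Adj (suc k)
  parentGraph x y = isChildOf x y ∨ isChildOf y x

  data ParentEdge : Fin (suc k) → Fin (suc k) → Set where
    down : ∀ a → ParentEdge (suc a) (par a)
    up : ∀ a → ParentEdge (par a) (suc a)

  childEdge : ∀ a → parentGraph (suc a) (par a) ≡ true
  childEdge a with par a ≟ par a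
  ... | yes _ = refl
  ... | no differ = ⊥-elim (differ refl)

  isChildOf⇒edge : ∀ x y → isChildOf x y ≡ true → ParentEdge x y
  isChildOf⇒edge (suc a) y e with par a ≟ y
  ... | yes refl = down a
  isChildOf⇒edge (suc a) y () | no _

  flipEdge : ∀ {x y} → ParentEdge x y → ParentEdge y x
  flipEdge (down a) = up a
  flipEdge (up a) = down a

  edgeView : ∀ x y → parentGraph x y ≡ true → ParentEdge x y
  edgeView x y e with isChildOf x y in child
  ... | true = isChildOf⇒edge x y child
  ... | false = flipEdge (isChildOf⇒edge y x e)

  parentGraph-sym : Symmetric parentGraph
  parentGraph-sym x y = Bool.∨-comm (isChildOf x y) (isChildOf y x)

  module Earlier (earlier : ∀ a → toℕ (par a) ≤ toℕ a) where

    parent<child : ∀ a → toℕ (par a) < toℕ (suc a)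
    parent<child a = s≤s (earlier a)

    edgeDistinct : ∀ {x y} → ParentEdge x y → x ≢ y
    edgeDistinct (down a) same = ℕ.<-irrefl (cong toℕ (sym same)) (parent<child a)
    edgeDistinct (up a) same = ℕ.<-irrefl (cong toℕ same) (parent<child a)

    edgeToEarlier : ∀ {x y} → parentGraph x y ≡ true → toℕ y ≤ toℕ x → y ≡ parentOf x
    edgeToEarlier {x} {y} e y≤x with edgeView x y e
    ... | down a = refl
    ... | up a = ⊥-elim (ℕ.<⇒≱ (parent<child a) y≤x)

    irreflexive : ∀ x → parentGraph x x ≡ false
    irreflexive x with parentGraph x x in e
    ... | false = refl
    ... | true = ⊥-elim (edgeDistinct (edgeView x x e) refl)

    toRoot : ∀ x → Acc Data.Fin._<_ x → Reach parentGraph x zero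
    toRoot zero _ = ε
    toRoot (suc a) (acc rs) = childEdge a ◅ toRoot (par a) (rs (parent<child a))

    connected : Connected parentGraph
    connected x y =
      toRoot x (<-wellFounded x) ◅◅ reverseWalk parentGraph-sym (toRoot y (<-wellFounded y))

    -- The latest vertex ℓ of a cycle has two distinct cycle neighbours, both
    -- earlier, hence both equal to its parent.
    acyclic : ¬ HasCycle parentGraph
    acyclic (m , c , c-inj , path , close) = latestHasOneParent (maxPosition (toℕ ∘ c))
      where
      latestHasOneParent : (Σ _ λ ℓ → ∀ i → toℕ (c i) ≤ toℕ (c ℓ)) → ⊥
      latestHasOneParent (ℓ , latest)
        with cycleNeighbours parentGraph parentGraph-sym c path close ℓ
      ... | p₁ , p₂ , p₁≢p₂ , e₁ , e₂ =
        p₁≢p₂ (c-inj (trans (edgeToEarlier e₁ (latest p₁))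
                             (sym (edgeToEarlier e₂ (latest p₂)))))

    isTree : IsTree parentGraph
    isTree = (parentGraph-sym , irreflexive) , connected , acyclic

-- Growing a tree inside a connected component.

snoc : ∀ {A : Set} {j} → (Fin j → A) → A → Fin (suc j) → A
snoc {j = zero} f x _ = x
snoc {j = suc j} f x zero = f zero
snoc {j = suc j} f x (suc a) = snoc (f ∘ suc) x a

snoc-last : ∀ {A : Set} j (f : Fin j → A) x → snoc f x (fromℕ j) ≡ x
snoc-last zero f x = refl
snoc-last (suc j) f x = snoc-last j (f ∘ suc) x

snoc-inject₁ : ∀ {A : Set} {j} (f : Fin j → A) x (a : Fin j) → snoc f x (inject₁ a) ≡ f a
snoc-inject₁ {j = suc j} f x zero = refl
snoc-inject₁ {j = suc j} f x (suc a) = snoc-inject₁ (f ∘ suc) x a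

record RootedTree {n : ℕ} (B : Adj n) (v : Fin n) (j : ℕ) : Set where
  field
    vertex : Fin (suc j) → Fin n
    vertex-injective : Injective _≡_ _≡_ vertex
    vertex-root : vertex zero ≡ v
    parent : Fin j → Fin (suc j)
    parent-earlier : ∀ a → toℕ (parent a) ≤ toℕ a
    parent-edge : ∀ a → B (vertex (suc a)) (vertex (parent a)) ≡ true

singleVertex : ∀ {n} {B : Adj n} {v} → RootedTree B v 0
singleVertex {v = v} = record
  { vertex = λ _ → v
  ; vertex-injective = λ { {zero} {zero} _ → refl }
  ; vertex-root = refl
  ; parent = λ ()
  ; parent-earlier = λ ()
  ; parent-edge = λ ()
  }

attachLeaf : ∀ {n} {B : Adj n} {v j} (R : RootedTree B v j) (w : Fin n) →
  ¬ InImage (RootedTree.vertex R) w → (i : Fin (suc j)) →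
  B w (RootedTree.vertex R i) ≡ true → RootedTree B v (suc j)
attachLeaf {n} {B} {v} {j} R w new i leafEdge = record
  { vertex = vertex⁺
  ; vertex-injective = injective⁺
  ; vertex-root = vertex-root
  ; parent = parent⁺
  ; parent-earlier = earlier⁺
  ; parent-edge = edge⁺
  }
  where
  open RootedTree R
  open ℕ.≤-Reasoning

  vertex⁺ : Fin (suc (suc j)) → Fin n
  vertex⁺ = snoc vertex w

  parent⁺ : Fin (suc j) → Fin (suc (suc j))
  parent⁺ = snoc (inject₁ ∘ parent) (inject₁ i)

  old : ∀ a → vertex⁺ (inject₁ a) ≡ vertex a
  old = snoc-inject₁ vertex w

  leaf : vertex⁺ (fromℕ (suc j)) ≡ w
  leaf = snoc-last (suc j) vertex w

  injective⁺ : Injective _≡_ _≡_ vertex⁺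
  injective⁺ {x} {y} same with view x | view y
  ... | ‵fromℕ | ‵fromℕ = refl
  ... | ‵fromℕ | ‵inject₁ b = ⊥-elim (new (b , trans (sym (old b)) (trans (sym same) leaf)))
  ... | ‵inject₁ a | ‵fromℕ = ⊥-elim (new (a , trans (sym (old a)) (trans same leaf)))
  ... | ‵inject₁ a | ‵inject₁ b =
    cong inject₁ (vertex-injective (trans (sym (old a)) (trans same (old b))))

  earlier⁺ : ∀ a → toℕ (parent⁺ a) ≤ toℕ a
  earlier⁺ a with view a
  ... | ‵fromℕ = begin
    toℕ (parent⁺ (fromℕ j)) ≡⟨ cong toℕ (snoc-last j (inject₁ ∘ parent) (inject₁ i)) ⟩
    toℕ (inject₁ i)         ≡⟨ toℕ-inject₁ i ⟩
    toℕ i                   ≤⟨ toℕ≤pred[n] i ⟩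
    j                       ≡⟨ toℕ-fromℕ j ⟨
    toℕ (fromℕ j)           ∎
  ... | ‵inject₁ b = begin
    toℕ (parent⁺ (inject₁ b))   ≡⟨ cong toℕ (snoc-inject₁ (inject₁ ∘ parent) (inject₁ i) b) ⟩
    toℕ (inject₁ (parent b))    ≡⟨ toℕ-inject₁ (parent b) ⟩
    toℕ (parent b)              ≤⟨ parent-earlier b ⟩
    toℕ b                       ≡⟨ toℕ-inject₁ b ⟨
    toℕ (inject₁ b)             ∎

  parentOfLeaf : vertex⁺ (parent⁺ (fromℕ j)) ≡ vertex i
  parentOfLeaf = trans (cong vertex⁺ (snoc-last j (inject₁ ∘ parent) (inject₁ i))) (old i)

  parentOfOld : ∀ b → vertex⁺ (parent⁺ (inject₁ b)) ≡ vertex (parent b)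
  parentOfOld b =
    trans (cong vertex⁺ (snoc-inject₁ (inject₁ ∘ parent) (inject₁ i) b)) (old (parent b))

  edge⁺ : ∀ a → B (vertex⁺ (suc a)) (vertex⁺ (parent⁺ a)) ≡ true
  edge⁺ a with view a
  ... | ‵fromℕ = subst₂ (λ x y → B x y ≡ true) (sym leaf) (sym parentOfLeaf) leafEdge
  ... | ‵inject₁ b =
    subst₂ (λ x y → B x y ≡ true) (sym (old (suc b))) (sym (parentOfOld b)) (parent-edge b)

rootedTreeCopy : ∀ {n} {B : Adj n} {v j} → Symmetric B → RootedTree B v j → HasTree B (suc j)
rootedTreeCopy {B = B} symB R = parentGraph , isTree , vertex , vertex-injective , embeds
  where
  open RootedTree R
  open ParentGraph parent
  open Earlier parent-earlier
  embeds : ∀ x y → parentGraph x y ≡ true → B (vertex x) (vertex y) ≡ true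
  embeds x y e with edgeView x y e
  ... | down a = parent-edge a
  ... | up a = trans (symB _ _) (parent-edge a)

-- While the tree is smaller than its component, a walk from the root to a
-- vertex outside the tree leaves the tree along an edge, giving a new leaf.
growByOne : ∀ {n} {B : Adj n} → Symmetric B → ∀ {v m j} → HasSize (Comp B v) m →
  RootedTree B v j → suc j < m → RootedTree B v (suc j)
growByOne symB component R@(record { vertex = vertex ; vertex-root = root }) j<m
  with outsideImage component vertex j<m
... | x , walk , outside with exitEdge (InImage vertex) (inImage? vertex) walk (zero , root) outside
... | _ , w , (i , refl) , new , edge = attachLeaf R w new i (trans (symB w _) edge)

growTree : ∀ {n} {B : Adj n} → Symmetric B → ∀ {v m} → HasSize (Comp B v) m →
  ∀ j → j < m → RootedTree B v j
growTree symB component zero _ = singleVertex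
growTree symB component (suc j) j<m =
  growByOne symB component (growTree symB component j (ℕ.<-trans (ℕ.n<1+n j) j<m)) j<m

largeComponentHasTree : ∀ {n} {B : Adj n} → Symmetric B → ∀ {v m k} →
  HasSize (Comp B v) m → 0 < k → k ≤ m → HasTree B k
largeComponentHasTree symB {k = suc j} component _ k≤m =
  rootedTreeCopy symB (growTree symB component j k≤m)

-- Adding a non-edge uv to G and colouring it blue.

allPairsOrCounterexample : ∀ {k} {P : Fin k → Fin k → Set} → (∀ a b → Dec (P a b)) →
  (∀ a b → P a b) ⊎ Σ (Fin k) λ a → Σ (Fin k) λ b → ¬ P a b
allPairsOrCounterexample P? with all? (λ a → all? (P? a))
... | yes everywhere = inj₁ everywhere
... | no notAll with ¬∀⟶∃¬ _ _ (λ a → all? (P? a)) notAll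
...   | a , notAllB = inj₂ (a , ¬∀⟶∃¬ _ _ (P? a) notAllB)

failedImplication : ∀ (p : Bool) {X : Set} → ¬ (p ≡ true → X) → p ≡ true × ¬ X
failedImplication true fails = refl , λ x → fails (λ _ → x)
failedImplication false fails = ⊥-elim (fails (λ ()))

module AddBlueEdge {n : ℕ} (G : Adj n) (c : Colouring n) (u v : Fin n) where

  isNewPair : Fin n → Fin n → Bool
  isNewPair x y = (⌊ x ≟ u ⌋ ∧ ⌊ y ≟ v ⌋) ∨ (⌊ x ≟ v ⌋ ∧ ⌊ y ≟ u ⌋)

  NewPair : Fin n → Fin n → Set
  NewPair x y = (x ≡ u × y ≡ v) ⊎ (x ≡ v × y ≡ u)

  isNewPair⇒ : ∀ x y → isNewPair x y ≡ true → NewPair x y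
  isNewPair⇒ x y e with x ≟ u | y ≟ v | x ≟ v | y ≟ u
  ... | yes x≡u | yes y≡v | _ | _ = inj₁ (x≡u , y≡v)
  ... | _ | _ | yes x≡v | yes y≡u = inj₂ (x≡v , y≡u)
  isNewPair⇒ x y () | yes _ | no _ | yes _ | no _
  isNewPair⇒ x y () | yes _ | no _ | no _ | _
  isNewPair⇒ x y () | no _ | _ | yes _ | no _
  isNewPair⇒ x y () | no _ | _ | no _ | _

  isNewPair-sym : ∀ x y → isNewPair x y ≡ isNewPair y x
  isNewPair-sym x y = begin
    (⌊ x ≟ u ⌋ ∧ ⌊ y ≟ v ⌋) ∨ (⌊ x ≟ v ⌋ ∧ ⌊ y ≟ u ⌋)
      ≡⟨ cong₂ _∨_ (Bool.∧-comm ⌊ x ≟ u ⌋ _) (Bool.∧-comm ⌊ x ≟ v ⌋ _) ⟩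
    (⌊ y ≟ v ⌋ ∧ ⌊ x ≟ u ⌋) ∨ (⌊ y ≟ u ⌋ ∧ ⌊ x ≟ v ⌋)
      ≡⟨ Bool.∨-comm (⌊ y ≟ v ⌋ ∧ ⌊ x ≟ u ⌋) _ ⟩
    (⌊ y ≟ u ⌋ ∧ ⌊ x ≟ v ⌋) ∨ (⌊ y ≟ v ⌋ ∧ ⌊ x ≟ u ⌋) ∎
    where open ≡-Reasoning

  colour⁺ : Colouring n
  colour⁺ = record
    { col = λ x y → if isNewPair x y then blue else col c x y
    ; col-sym = λ x y →
        cong₂ (λ p κ → if p then blue else κ) (isNewPair-sym x y) (col-sym c x y)
    }

  G⁺ : Adj n
  G⁺ = addEdge G u v

  B : Adj n
  B = blueAdj G c

  B⁺ : Adj n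
  B⁺ = blueAdj G⁺ colour⁺

  -- Boolean core of the comparison of the two colourings: an edge that is
  -- red in the new colouring was red before; a new blue edge is old or new.
  redBefore : ∀ (g p : Bool) (κ : Colour) →
    (g ∨ p) ∧ isRed (if p then blue else κ) ≡ true → g ∧ isRed κ ≡ true
  redBefore true false κ e = e
  redBefore false false κ e = e
  redBefore true true κ ()
  redBefore false true κ ()

  blueBeforeOrNew : ∀ (g p : Bool) (κ : Colour) →
    (g ∨ p) ∧ not (isRed (if p then blue else κ)) ≡ true →
    g ∧ not (isRed κ) ≡ true ⊎ p ≡ true
  blueBeforeOrNew g true κ _ = inj₂ refl
  blueBeforeOrNew true false κ e = inj₁ e
  blueBeforeOrNew false false κ e = inj₁ e

  red⁺⇒red : ∀ x y → redAdj G⁺ colour⁺ x y ≡ true → redAdj G c x y ≡ true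
  red⁺⇒red x y = redBefore (G x y) (isNewPair x y) (col c x y)

  blue⁺⇒blueOrNew : ∀ x y → B⁺ x y ≡ true → B x y ≡ true ⊎ NewPair x y
  blue⁺⇒blueOrNew x y e =
    Sum.map₂ (isNewPair⇒ x y) (blueBeforeOrNew (G x y) (isNewPair x y) (col c x y) e)

  NearNewPair : Fin n → Set
  NearNewPair z = Reach B u z ⊎ Reach B v z

  newPairNearˡ : ∀ {x y} → NewPair x y → NearNewPair x
  newPairNearˡ (inj₁ (refl , _)) = inj₁ ε
  newPairNearˡ (inj₂ (refl , _)) = inj₂ ε

  newPairNearʳ : ∀ {x y} → NewPair x y → NearNewPair y
  newPairNearʳ (inj₁ (_ , refl)) = inj₂ ε
  newPairNearʳ (inj₂ (_ , refl)) = inj₁ ε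

  walk⁺Stays : ∀ {z w} → Reach B⁺ z w → NearNewPair z → NearNewPair w
  walk⁺Stays ε near = near
  walk⁺Stays (_◅_ {i = z} {j = w} e walk) near with blue⁺⇒blueOrNew z w e
  ... | inj₁ old = walk⁺Stays walk (Sum.map (_◅◅ (old ◅ ε)) (_◅◅ (old ◅ ε)) near)
  ... | inj₂ new = walk⁺Stays walk (newPairNearʳ new)

  allOldOrSomeNew : ∀ {k} (T : Adj k) (f : Fin k → Fin n) →
    (∀ a b → T a b ≡ true → B (f a) (f b) ≡ true) ⊎
    Σ (Fin k) λ a → Σ (Fin k) λ b → T a b ≡ true × ¬ B (f a) (f b) ≡ true
  allOldOrSomeNew T f
    with allPairsOrCounterexample (λ a b → (T a b Bool.≟ true) →-dec (B (f a) (f b) Bool.≟ true))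
  ... | inj₁ allOld = inj₁ allOld
  ... | inj₂ (a , b , notOld) = inj₂ (a , b , failedImplication (T a b) notOld)

  treeNearNewPair : ∀ {t k} → CriticalColouring G t k c → Arrows G⁺ t k →
    Σ (Fin k → Fin n) λ f → Injective _≡_ _≡_ f × ∀ j → NearNewPair (f j)
  treeNearNewPair (noRedClique , noBlueTree) arrows with arrows colour⁺
  ... | inj₁ (f , f-inj , redEdges) =
    ⊥-elim (noRedClique (f , f-inj , λ i j i≢j → red⁺⇒red _ _ (redEdges i j i≢j)))
  ... | inj₂ (T , isTree@(_ , connected , _) , f , f-inj , embeds) with allOldOrSomeNew T f
  ...   | inj₁ allOld = ⊥-elim (noBlueTree (T , isTree , f , f-inj , allOld))
  ...   | inj₂ (a , b , Tab , notOld) =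
    f , f-inj , λ j → walk⁺Stays (gmap f (embeds _ _) (connected a j)) start
    where
    start : NearNewPair (f a)
    start with blue⁺⇒blueOrNew (f a) (f b) (embeds a b Tab)
    ... | inj₁ old = ⊥-elim (notOld old)
    ... | inj₂ new = newPairNearˡ new

halvesBelow : ∀ a b {k} → 2 * a < k → 2 * b < k → a + b < k
halvesBelow a b {k} 2a<k 2b<k = ℕ.*-cancelˡ-≤ 2 (begin
  2 * suc (a + b)           ≡⟨ solve 2 (λ a b → con 2 :* (con 1 :+ (a :+ b))
                                           := (con 1 :+ con 2 :* a) :+ (con 1 :+ con 2 :* b)) refl a b ⟩
  suc (2 * a) + suc (2 * b) ≤⟨ ℕ.+-mono-≤ 2a<k 2b<k ⟩
  k + k                     ≡⟨ solve 1 (λ k → k :+ k := con 2 :* k) refl k ⟩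
  2 * k                     ∎)
  where
  open ℕ.≤-Reasoning
  open +-*-Solver

unreachable⇒distinct : ∀ {n} {A : Adj n} {x y} → ¬ Reach A x y → x ≢ y
unreachable⇒distinct apart refl = apart ε

module CriticalColouringOfCoCritical
  {t k n : ℕ} {G : Adj n} (simple : IsSimple G)
  (addArrows : ∀ u v → u ≢ v → G u v ≡ false → Arrows (addEdge G u v) t k)
  (c : Colouring n) (critical : CriticalColouring G t k c) where

  B : Adj n
  B = blueAdj G c

  blueSymmetric : Symmetric B
  blueSymmetric x y = cong₂ (λ g κ → g ∧ not (isRed κ)) (proj₁ simple x y) (col-sym c x y)

  nonEdgeSpan : ∀ x y → x ≢ y → G x y ≡ false →
    Σ (Fin k → Fin n) λ f → Injective _≡_ _≡_ f × ∀ j → Comp B x (f j) ⊎ Comp B y (f j)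
  nonEdgeSpan x y x≢y nonEdge =
    AddBlueEdge.treeNearNewPair G c x y critical (addArrows x y x≢y nonEdge)

  componentBelow : 0 < k → ∀ v {m} → HasSize (Comp B v) m → m < k
  componentBelow 0<k v {m} size with k ≤? m
  ... | yes k≤m = ⊥-elim (proj₂ critical (largeComponentHasTree blueSymmetric size 0<k k≤m))
  ... | no k≰m = ℕ.≰⇒> k≰m

  componentComplete : 0 < k → ∀ v {m} → HasSize (Comp B v) m →
    ∀ x y → Comp B v x → Comp B v y → x ≢ y → G x y ≡ true
  componentComplete 0<k v size x y vx vy x≢y with G x y in edge
  ... | true = refl
  ... | false with nonEdgeSpan x y x≢y edge
  ...   | f , f-inj , near = ⊥-elim (ℕ.<⇒≱ (componentBelow 0<k v size)
          (atMost-injection (atMost-⊆ (λ _ → Sum.[ vx ◅◅_ , vy ◅◅_ ]) (sized⇒atMost size))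
             f f-inj near))

  smallComponentsRed : ∀ x y → SmallComp B k x → SmallComp B k y → ¬ Reach B x y →
    redAdj G c x y ≡ true
  smallComponentsRed x y (a , sizeX , smallX) (b , sizeY , smallY) apart
    with G x y in edge | col c x y in colour
  ... | true | red = refl
  ... | true | blue = ⊥-elim (apart (cong₂ (λ g κ → g ∧ not (isRed κ)) edge colour ◅ ε))
  ... | false | _ with nonEdgeSpan x y (unreachable⇒distinct apart) edge
  ...   | f , f-inj , near = ⊥-elim (ℕ.<⇒≱ (halvesBelow a b smallX smallY)
          (atMost-injection (atMost-∪ (sized⇒atMost sizeX) (sized⇒atMost sizeY)) f f-inj near))

  fewSmallComponents : ∀ q (r : Fin q → Fin n) → (∀ i → SmallComp B k (r i)) →
    (∀ i j → i ≢ j → ¬ Reach B (r i) (r j)) → q < t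
  fewSmallComponents q r small apart with t ≤? q
  ... | no t≰q = ℕ.≰⇒> t≰q
  ... | yes t≤q = ⊥-elim (proj₁ critical (r ∘ pick , r∘pick-injective , redEdges))
    where
    pick : Fin t → Fin q
    pick i = inject≤ i t≤q
    pick-injective : Injective _≡_ _≡_ pick
    pick-injective {i} {j} = inject≤-injective t≤q t≤q i j
    r-injective : Injective _≡_ _≡_ r
    r-injective {i} {j} same with i ≟ j
    ... | yes i≡j = i≡j
    ... | no i≢j = ⊥-elim (apart i j i≢j (subst (Reach B (r i)) same ε))
    r∘pick-injective : Injective _≡_ _≡_ (r ∘ pick)
    r∘pick-injective = pick-injective ∘ r-injective
    redEdges : ∀ i j → i ≢ j → redAdj G c (r (pick i)) (r (pick j)) ≡ true
    redEdges i j i≢j = smallComponentsRed _ _ (small (pick i)) (small (pick j))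
      (apart (pick i) (pick j) (i≢j ∘ pick-injective))

lemma2p1 : (t k n : ℕ) → 3 ≤ t → 3 ≤ k → (G : Adj n) → IsSimple G →
    CoCritical G t k → (c : Colouring n) → CriticalColouring G t k c →
    ((v : Fin n) → (m : ℕ) → HasSize (Comp (blueAdj G c) v) m →
        m ≤ k ∸ 1 ×
        ((x y : Fin n) → Comp (blueAdj G c) v x → Comp (blueAdj G c) v y →
           x ≢ y → G x y ≡ true)) ×
    (((u v : Fin n) → SmallComp (blueAdj G c) k u → SmallComp (blueAdj G c) k v →
        ¬ Reach (blueAdj G c) u v → redAdj G c u v ≡ true) ×
     ((q : ℕ) → (r : Fin q → Fin n) →
        ((i : Fin q) → SmallComp (blueAdj G c) k (r i)) →
        ((i j : Fin q) → i ≢ j → ¬ Reach (blueAdj G c) (r i) (r j)) →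
        ((v : Fin n) → SmallComp (blueAdj G c) k v →
           Σ (Fin q) λ i → Reach (blueAdj G c) (r i) v) →
        q ≤ t ∸ 1))
lemma2p1 t k n _ 3≤k G simple (_ , _ , addArrows) c critical =
  (λ v m size → ℕ.<⇒≤pred (componentBelow 0<k v size) , componentComplete 0<k v size) ,
  smallComponentsRed ,
  λ q r small apart _ → ℕ.<⇒≤pred (fewSmallComponents q r small apart)
  where
  open CriticalColouringOfCoCritical simple addArrows c critical
  0<k : 0 < k
  0<k = ℕ.<-≤-trans (s≤s z≤n) 3≤k
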